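{- In the setting described in the context, $|\mathcal{I}_1|\le\varepsilon\,\mathrm{OPT}+1$; consequently, packing each item of $\mathcal{I}_1$ into its own bin yields at most $\varepsilon\,\mathrm{OPT}+1$ feasible bins.
   Context: BPUP: an instance has items $\mathcal{I}$ with sizes $s_i\in[0,1]$, a rational $U\in(0,1]$, a positive integer $k$, bins of capacity $1$; the load of a nonempty item set $p$ in one bin is $\sum_{i\in p}s_i+\lfloor(|p|-1)/k\rfloor U$; a feasible solution partitions the items into bins of load at most $1$; $\mathrm{OPT}$ is the minimum number of bins of a feasible solution. Let $\varepsilon>0$ with $1/\varepsilon\in\mathbb{Z}$, and assume $\lfloor k/U\rfloor+k\le1/\varepsilon^2$. Sort $\mathcal{I}$ in non-increasing size order and split it into $1/\varepsilon^3$ classes of consecutive items $\mathcal{I}_1,\dots,\mathcal{I}_{1/\varepsilon^3}$ with $\lceil\varepsilon^3|\mathcal{I}|\rceil=|\mathcal{I}_1|\ge|\mathcal{I}_2|\ge\dots\ge|\mathcal{I}_{1/\varepsilon^3}|=\lfloor\varepsilon^3|\mathcal{I}|\rfloor$.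
   Formalization: The item sizes $s_i$ take only rational values in [0,1]. -}

module Defs where

open import Data.Nat as ℕ using (ℕ; NonZero; _∸_)
open import Data.Nat.DivMod as ℕD using ()
open import Data.Integer as ℤ using (+_)
open import Data.Rational as ℚ using (ℚ; _/_; _+_; _*_; _≤_; 0ℚ)
open import Data.List using (List; length; map; concat; allFin; foldr)
open import Data.List.Relation.Unary.All using (All)
open import Data.List.Relation.Binary.Permutation.Propositional using (_↭_)
open import Data.Fin using (Fin)
open import Data.Product using (_×_; Σ)
open import Relation.Binary.PropositionalEquality using (_≡_)

ℕ→ℚ : ℕ → ℚ
ℕ→ℚ x = + x / 1

sumℚ : List ℚ → ℚ
sumℚ = foldr _+_ 0ℚ

load : ∀ {n} (s : Fin n → ℚ) (U : ℚ) (k : ℕ) .{{_ : NonZero k}} →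
       List (Fin n) → ℚ
load s U k p = sumℚ (map s p) + ℕ→ℚ (ℕD._/_ (length p ∸ 1) k) * U

FeasiblePacking : ∀ {n} (s : Fin n → ℚ) (U : ℚ) (k : ℕ) .{{_ : NonZero k}} →
                  List (Fin n) → List (List (Fin n)) → Set
FeasiblePacking s U k items bins =
  (concat bins ↭ items) × All (λ p → load s U k p ≤ ℚ.1ℚ) bins

IsOPT : ∀ {n} (s : Fin n → ℚ) (U : ℚ) (k : ℕ) .{{_ : NonZero k}} → ℕ → Set
IsOPT {n} s U k opt =
  Σ (List (List (Fin n))) (λ bins →
     FeasiblePacking s U k (allFin n) bins × length bins ≡ opt)
  × ((bins : List (List (Fin n))) →
     FeasiblePacking s U k (allFin n) bins → opt ℕ.≤ length bins)

-- A bin of load at most 1 holding L items pays the penalty ⌊(L-1)/k⌋·U ≤ 1, so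
-- k⌊(L-1)/k⌋ ≤ ⌊k/U⌋ and hence L ≤ ⌊k/U⌋ + k ≤ 1/ε².  An optimal packing therefore
-- has n ≤ OPT/ε², so |I₁| ≤ ⌈ε³n⌉ ≤ ε³n + 1 ≤ ε·OPT + 1.  Singletons always fit,
-- since a single item pays no penalty.
module Submission where

open import Defs
open import Data.Nat as ℕ using (ℕ; NonZero; _^_; zero; suc; z≤n)
import Data.Nat.Properties as ℕ
open import Data.Nat.DivMod using (m≡m%n+[m/n]*n; m%n<n)
open import Data.Nat.Coprimality as Coprime using (1-coprimeTo)
open import Data.Integer as ℤ using (+_; -[1+_]; ∣_∣; +≤+; _/ℕ_)
import Data.Integer.Properties as ℤ
open import Data.Integer.DivMod using (div-pos-is-/ℕ; [n/ℕd]*d≤n; n<s[n/ℕd]*d)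
open import Data.Rational as ℚ
  using (ℚ; mkℚ; ↥_; ↧_; ↧ₙ_; _/_; _+_; _*_; _≤_; _<_; 0ℚ; 1ℚ; _÷_; floor; ceiling;
         *≤*; *<*; NonNegative; positive)
import Data.Rational.Properties as ℚ
open import Data.Rational.Solver using (module +-*-Solver)
open +-*-Solver using (solve; _:*_; _:=_)
open import Data.Fin using (Fin)
open import Data.List using (List; []; _∷_; _++_; length; map; concat; take; allFin; [_])
import Data.List.Properties as List
open import Data.List.Relation.Unary.All as All using (All; []; _∷_)
import Data.List.Relation.Unary.All.Properties as All
open import Data.List.Relation.Unary.Linked using (Linked)
open import Data.List.Relation.Binary.Permutation.Propositional using (_↭_; ↭-reflexive)
open import Data.List.Relation.Binary.Permutation.Propositional.Properties using (↭-length)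
open import Data.Product using (_×_; _,_)
open import Relation.Binary.PropositionalEquality
  using (_≡_; refl; sym; trans; cong; subst; subst₂; module ≡-Reasoning)

ℕ→ℚ≡mkℚ : ∀ a → ℕ→ℚ a ≡ mkℚ (+ a) 0 (Coprime.sym (1-coprimeTo a))
ℕ→ℚ≡mkℚ a = ℚ.normalize-coprime (Coprime.sym (1-coprimeTo a))

ℕ→ℚ-nonNeg : ∀ a → NonNegative (ℕ→ℚ a)
ℕ→ℚ-nonNeg a = ℚ.normalize-nonNeg a 1

ℕ→ℚ-mono-≤ : ∀ {a b} → a ℕ.≤ b → ℕ→ℚ a ≤ ℕ→ℚ b
ℕ→ℚ-mono-≤ {a} {b} a≤b rewrite ℕ→ℚ≡mkℚ a | ℕ→ℚ≡mkℚ b =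
  *≤* (ℤ.*-monoʳ-≤-nonNeg (+ 1) (+≤+ a≤b))

ℕ→ℚ-suc : ∀ a → ℕ→ℚ (suc a) ≡ ℕ→ℚ a + 1ℚ
ℕ→ℚ-suc a rewrite ℕ→ℚ≡mkℚ a =
  cong (_/ 1) (trans (ℤ.+-comm (+ 1) (+ a)) (cong (ℤ._+ + 1) (sym (ℤ.*-identityʳ (+ a)))))

ℕ→ℚ-homo-* : ∀ a b → ℕ→ℚ (a ℕ.* b) ≡ ℕ→ℚ a * ℕ→ℚ b
ℕ→ℚ-homo-* a b rewrite ℕ→ℚ≡mkℚ a | ℕ→ℚ≡mkℚ b = cong (_/ 1) (ℤ.pos-* a b)

1/m*m≡1 : ∀ m .{{_ : NonZero m}} → (+ 1 / m) * ℕ→ℚ m ≡ 1ℚ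
1/m*m≡1 m@(suc _) rewrite ℕ→ℚ≡mkℚ m | ℚ.normalize-coprime (1-coprimeTo m) =
  ℚ.*-inverseˡ (mkℚ (+ m) 0 (Coprime.sym (1-coprimeTo m)))

i*d≤n⇒i≤n/ℕd : ∀ {i} n d .{{_ : NonZero d}} → i ℤ.* + d ℤ.≤ n → i ℤ.≤ n /ℕ d
i*d≤n⇒i≤n/ℕd n d i*d≤n = subst (_ ℤ.≤_) (ℤ.pred-suc (n /ℕ d))
  (ℤ.i<j⇒i≤pred[j] (ℤ.*-cancelʳ-<-nonNeg {j = ℤ.suc (n /ℕ d)} (+ d)
    (ℤ.≤-<-trans i*d≤n (n<s[n/ℕd]*d n d))))

n≤-[-n/ℕd]*d : ∀ n d .{{_ : NonZero d}} → n ℤ.≤ ℤ.- ((ℤ.- n) /ℕ d) ℤ.* + d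
n≤-[-n/ℕd]*d n d = subst₂ ℤ._≤_ (ℤ.neg-involutive n) (ℤ.neg-distribˡ-* ((ℤ.- n) /ℕ d) (+ d))
  (ℤ.neg-mono-≤ ([n/ℕd]*d≤n (ℤ.- n) d))

pred[-[-n/ℕd]]*d<n : ∀ n d .{{_ : NonZero d}} → ℤ.pred (ℤ.- ((ℤ.- n) /ℕ d)) ℤ.* + d ℤ.< n
pred[-[-n/ℕd]]*d<n n d = subst₂ ℤ._<_
  (trans (ℤ.neg-distribˡ-* (ℤ.suc q) (+ d)) (cong (ℤ._* + d) (ℤ.neg-distrib-+ (+ 1) q)))
  (ℤ.neg-involutive n)
  (ℤ.neg-mono-< (n<s[n/ℕd]*d (ℤ.- n) d))
  where q = (ℤ.- n) /ℕ d

floor-/ℕ : ∀ p → floor p ≡ ↥ p /ℕ ↧ₙ p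
floor-/ℕ p@record{} = div-pos-is-/ℕ (↥ p) (↧ₙ p)

ceiling-/ℕ : ∀ p → ceiling p ≡ ℤ.- ((ℤ.- ↥ p) /ℕ ↧ₙ p)
ceiling-/ℕ (mkℚ (+ 0)       d _) = cong ℤ.-_ (div-pos-is-/ℕ (+ 0) (suc d))
ceiling-/ℕ (mkℚ ℤ.+[1+ a ]  d _) = cong ℤ.-_ (div-pos-is-/ℕ -[1+ a ] (suc d))
ceiling-/ℕ (mkℚ -[1+ a ]    d _) = cong ℤ.-_ (div-pos-is-/ℕ ℤ.+[1+ a ] (suc d))

floor-greatest : ∀ a p → ℕ→ℚ a ≤ p → + a ℤ.≤ floor p
floor-greatest a p@record{} a≤p rewrite ℕ→ℚ≡mkℚ a | floor-/ℕ p with a≤p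
... | *≤* a*d≤n*1 = i*d≤n⇒i≤n/ℕd (↥ p) (↧ₙ p) (subst (+ a ℤ.* ↧ p ℤ.≤_) (ℤ.*-identityʳ (↥ p)) a*d≤n*1)

ceiling≤+1 : ∀ p → 0ℚ ≤ p → ℕ→ℚ ∣ ceiling p ∣ ≤ p + 1ℚ
ceiling≤+1 p@(mkℚ (+ a) d _) 0≤p rewrite ceiling-/ℕ p
  with ℤ.- ((ℤ.- + a) /ℕ suc d) | n≤-[-n/ℕd]*d (+ a) (suc d) | pred[-[-n/ℕd]]*d<n (+ a) (suc d)
... | + 0      | _  | _     = ℚ.+-mono-≤ {0ℚ} {p} {0ℚ} {1ℚ} 0≤p (*≤* (+≤+ z≤n))
... | -[1+ _ ] | () | _
... | + suc c  | _  | c*d<a = begin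
  ℕ→ℚ (suc c) ≡⟨ ℕ→ℚ-suc c ⟩
  ℕ→ℚ c + 1ℚ  ≤⟨ ℚ.+-monoˡ-≤ 1ℚ (ℚ.<⇒≤ c<p) ⟩
  p + 1ℚ      ∎
  where
  open ℚ.≤-Reasoning
  c<p : ℕ→ℚ c < p
  c<p rewrite ℕ→ℚ≡mkℚ c = *<* (subst (+ c ℤ.* + suc d ℤ.<_) (sym (ℤ.*-identityʳ (+ a))) c*d<a)
ceiling≤+1 (mkℚ -[1+ _ ] _ _) (*≤* ())

p*u≤1⇒r*p≤r÷u : ∀ r .{{_ : NonNegative r}} {p} u .{{_ : ℚ.NonZero u}} → 0ℚ < u →
                p * u ≤ 1ℚ → r * p ≤ r ÷ u
p*u≤1⇒r*p≤r÷u r {p} u u>0 pu≤1 = ℚ.*-cancelʳ-≤-pos u {{positive u>0}} (begin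
  r * p * u        ≡⟨ ℚ.*-assoc r p u ⟩
  r * (p * u)      ≤⟨ ℚ.*-monoˡ-≤-nonNeg r pu≤1 ⟩
  r * 1ℚ           ≡⟨ cong (r *_) (ℚ.*-inverseˡ u) ⟨
  r * (ℚ.1/ u * u) ≡⟨ ℚ.*-assoc r (ℚ.1/ u) u ⟨
  r ÷ u * u        ∎)
  where open ℚ.≤-Reasoning

nonNeg³ : ∀ ε .{{_ : NonNegative ε}} → NonNegative (ε * ε * ε)
nonNeg³ ε = ℚ.nonNeg*nonNeg⇒nonNeg (ε * ε) {{ℚ.nonNeg*nonNeg⇒nonNeg ε ε}} ε

ε³*n≤ε*opt : ∀ ε .{{_ : NonNegative ε}} {m n opt} → ε * m ≡ 1ℚ → n ≤ m * m * opt →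
           ε * ε * ε * n ≤ ε * opt
ε³*n≤ε*opt ε {m} {n} {opt} εm≡1 n≤m²opt = begin
  ε * ε * ε * n                 ≤⟨ ℚ.*-monoˡ-≤-nonNeg (ε * ε * ε) {{nonNeg³ ε}} n≤m²opt ⟩
  ε * ε * ε * (m * m * opt)     ≡⟨ solve 3 (λ ε m opt → ε :* ε :* ε :* (m :* m :* opt)
                                                     := (ε :* m) :* (ε :* m) :* (ε :* opt)) refl ε m opt ⟩
  (ε * m) * (ε * m) * (ε * opt) ≡⟨ cong (λ x → x * x * (ε * opt)) εm≡1 ⟩
  1ℚ * 1ℚ * (ε * opt)           ≡⟨ ℚ.*-identityˡ (ε * opt) ⟩
  ε * opt                       ∎
  where open ℚ.≤-Reasoning

m≤n*[[m∸1]/n]+n : ∀ m n .{{_ : NonZero n}} → m ℕ.≤ n ℕ.* ((m ℕ.∸ 1) ℕ./ n) ℕ.+ n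
m≤n*[[m∸1]/n]+n zero    n = z≤n
m≤n*[[m∸1]/n]+n (suc m) n = begin
  suc m                     ≡⟨ cong suc (m≡m%n+[m/n]*n m n) ⟩
  suc (m ℕ.% n ℕ.+ q ℕ.* n) ≤⟨ ℕ.+-monoˡ-≤ (q ℕ.* n) (m%n<n m n) ⟩
  n ℕ.+ q ℕ.* n             ≡⟨ trans (ℕ.+-comm n (q ℕ.* n)) (cong (ℕ._+ n) (ℕ.*-comm q n)) ⟩
  n ℕ.* q ℕ.+ n             ∎
  where
  open ℕ.≤-Reasoning
  q = m ℕ./ n

length-take≤ : ∀ {A : Set} c (xs : List A) → length (take c xs) ℕ.≤ c
length-take≤ c xs = ℕ.≤-trans (ℕ.≤-reflexive (List.length-take c xs)) (ℕ.m⊓n≤m c (length xs))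

length-concat≤ : ∀ {A : Set} c (bs : List (List A)) → All (λ b → length b ℕ.≤ c) bs →
                 length (concat bs) ℕ.≤ c ℕ.* length bs
length-concat≤ c []       []           = z≤n
length-concat≤ c (b ∷ bs) (b≤c ∷ bs≤c) = begin
  length (b ++ concat bs)         ≡⟨ List.length-++ b ⟩
  length b ℕ.+ length (concat bs) ≤⟨ ℕ.+-mono-≤ b≤c (length-concat≤ c bs bs≤c) ⟩
  c ℕ.+ c ℕ.* length bs           ≡⟨ ℕ.*-suc c (length bs) ⟨
  c ℕ.* suc (length bs)           ∎
  where open ℕ.≤-Reasoning

sumℚ-nonNeg : ∀ {xs} → All (0ℚ ≤_) xs → 0ℚ ≤ sumℚ xs
sumℚ-nonNeg []           = ℚ.≤-refl
sumℚ-nonNeg (x≥0 ∷ xs≥0) = ℚ.+-mono-≤ {0ℚ} {_} {0ℚ} x≥0 (sumℚ-nonNeg xs≥0)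

penalty≤load : ∀ {n} (s : Fin n → ℚ) → (∀ i → 0ℚ ≤ s i) → (U : ℚ) (k : ℕ) .{{_ : NonZero k}} →
               ∀ p → ℕ→ℚ ((length p ℕ.∸ 1) ℕ./ k) * U ≤ load s U k p
penalty≤load s s≥0 U k p = subst (_≤ load s U k p) (ℚ.+-identityˡ penalty)
  (ℚ.+-monoˡ-≤ penalty (sumℚ-nonNeg (All.map⁺ (All.universal s≥0 p))))
  where penalty = ℕ→ℚ ((length p ℕ.∸ 1) ℕ./ k) * U

load≤1⇒length≤ : ∀ {n} (s : Fin n → ℚ) → (∀ i → 0ℚ ≤ s i) →
                 (U : ℚ) .{{_ : ℚ.NonZero U}} → 0ℚ < U → (k : ℕ) .{{_ : NonZero k}} →
                 ∀ p → load s U k p ≤ 1ℚ → + length p ℤ.≤ floor (ℕ→ℚ k ÷ U) ℤ.+ + k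
load≤1⇒length≤ s s≥0 U U>0 k p load≤1 = begin
  + length p                ≤⟨ +≤+ (m≤n*[[m∸1]/n]+n (length p) k) ⟩
  + (k ℕ.* q) ℤ.+ + k       ≤⟨ ℤ.+-monoˡ-≤ (+ k) (floor-greatest (k ℕ.* q) (ℕ→ℚ k ÷ U) kq≤k/U) ⟩
  floor (ℕ→ℚ k ÷ U) ℤ.+ + k ∎
  where
  open ℤ.≤-Reasoning
  q = (length p ℕ.∸ 1) ℕ./ k
  kq≤k/U : ℕ→ℚ (k ℕ.* q) ≤ ℕ→ℚ k ÷ U
  kq≤k/U = subst (_≤ ℕ→ℚ k ÷ U) (sym (ℕ→ℚ-homo-* k q))
    (p*u≤1⇒r*p≤r÷u (ℕ→ℚ k) {{ℕ→ℚ-nonNeg k}} U U>0 (ℚ.≤-trans (penalty≤load s s≥0 U k p) load≤1))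

feasible⇒length≤ : ∀ {n} (s : Fin n → ℚ) → (∀ i → 0ℚ ≤ s i) →
                   (U : ℚ) .{{_ : ℚ.NonZero U}} → 0ℚ < U → (k : ℕ) .{{_ : NonZero k}} →
                   (c : ℕ) → floor (ℕ→ℚ k ÷ U) ℤ.+ + k ℤ.≤ + c →
                   ∀ {items bins} → FeasiblePacking s U k items bins →
                   length items ℕ.≤ c ℕ.* length bins
feasible⇒length≤ s s≥0 U U>0 k c cap {bins = bins} (concat↭items , fits) =
  subst (ℕ._≤ c ℕ.* length bins) (↭-length concat↭items)
    (length-concat≤ c bins (All.map (λ {p} → bin≤c p) fits))
  where
  bin≤c : ∀ p → load s U k p ≤ 1ℚ → length p ℕ.≤ c
  bin≤c p fit = ℤ.drop‿+≤+ (ℤ.≤-trans (load≤1⇒length≤ s s≥0 U U>0 k p fit) cap)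

load-[_] : ∀ {n} (s : Fin n → ℚ) (U : ℚ) (k : ℕ) .{{_ : NonZero k}} → ∀ i → load s U k [ i ] ≡ s i
load-[_] s U k@(suc _) i = begin
  (s i + 0ℚ) + 0ℚ * U ≡⟨ cong (λ x → (s i + 0ℚ) + x) (ℚ.*-zeroˡ U) ⟩
  (s i + 0ℚ) + 0ℚ     ≡⟨ ℚ.+-identityʳ _ ⟩
  s i + 0ℚ            ≡⟨ ℚ.+-identityʳ (s i) ⟩
  s i                 ∎
  where open ≡-Reasoning

singletons-feasible : ∀ {n} (s : Fin n → ℚ) → (∀ i → s i ≤ 1ℚ) → (U : ℚ) (k : ℕ) .{{_ : NonZero k}} →
                      ∀ xs → FeasiblePacking s U k xs (map [_] xs)
singletons-feasible s s≤1 U k xs =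
  ↭-reflexive (List.concat-map-[_] xs) ,
  All.map⁺ (All.universal (λ i → subst (_≤ 1ℚ) (sym (load-[_] s U k i)) (s≤1 i)) xs)

lemma6 : (n : ℕ) (s : Fin n → ℚ) → (∀ i → 0ℚ ≤ s i) → (∀ i → s i ≤ 1ℚ) →
         (U : ℚ) .{{_ : ℚ.NonZero U}} → 0ℚ < U → U ≤ 1ℚ →
         (k : ℕ) .{{_ : NonZero k}} →
         (m : ℕ) .{{_ : NonZero m}} →
         ((floor (ℕ→ℚ k ÷ U)) ℤ.+ + k) ℤ.≤ + (m ^ 2) →
         (order : List (Fin n)) → order ↭ allFin n →
         Linked (λ i j → s j ≤ s i) order →
         (opt : ℕ) → IsOPT s U k opt →
         let ε = + 1 / m
             I₁ = take ∣ ceiling (ε * ε * ε * ℕ→ℚ n) ∣ order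
         in (ℕ→ℚ (length I₁) ≤ ε * ℕ→ℚ opt + 1ℚ)
            × FeasiblePacking s U k I₁ (map [_] I₁)
            × (ℕ→ℚ (length (map [_] I₁)) ≤ ε * ℕ→ℚ opt + 1ℚ)
lemma6 n s s≥0 s≤1 U U>0 _ k m capacity order _ _ opt ((bins , packing , |bins|≡opt) , _) =
  |I₁|≤εopt+1 ,
  singletons-feasible s s≤1 U k I₁ ,
  subst (λ l → ℕ→ℚ l ≤ ε * ℕ→ℚ opt + 1ℚ) (sym (List.length-map [_] I₁)) |I₁|≤εopt+1
  where
  ε = + 1 / m
  x = ε * ε * ε * ℕ→ℚ n
  I₁ = take ∣ ceiling x ∣ order
  instance
    _ : NonNegative ε
    _ = ℚ.normalize-nonNeg 1 m
  n≤m²opt : n ℕ.≤ m ^ 2 ℕ.* opt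
  n≤m²opt = subst₂ ℕ._≤_ (List.length-tabulate {n = n} (λ i → i)) (cong (m ^ 2 ℕ.*_) |bins|≡opt)
    (feasible⇒length≤ s s≥0 U U>0 k (m ^ 2) capacity packing)
  m²opt≡ : ℕ→ℚ (m ^ 2 ℕ.* opt) ≡ ℕ→ℚ m * ℕ→ℚ m * ℕ→ℚ opt
  m²opt≡ = trans (cong (λ j → ℕ→ℚ (m ℕ.* j ℕ.* opt)) (ℕ.*-identityʳ m))
    (trans (ℕ→ℚ-homo-* (m ℕ.* m) opt) (cong (_* ℕ→ℚ opt) (ℕ→ℚ-homo-* m m)))
  x≥0 : 0ℚ ≤ x
  x≥0 = ℚ.nonNegative⁻¹ x {{ℚ.nonNeg*nonNeg⇒nonNeg (ε * ε * ε) {{nonNeg³ ε}} (ℕ→ℚ n) {{ℕ→ℚ-nonNeg n}}}}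
  |I₁|≤εopt+1 : ℕ→ℚ (length I₁) ≤ ε * ℕ→ℚ opt + 1ℚ
  |I₁|≤εopt+1 = begin
    ℕ→ℚ (length I₁)   ≤⟨ ℕ→ℚ-mono-≤ (length-take≤ ∣ ceiling x ∣ order) ⟩
    ℕ→ℚ ∣ ceiling x ∣ ≤⟨ ceiling≤+1 x x≥0 ⟩
    x + 1ℚ            ≤⟨ ℚ.+-monoˡ-≤ 1ℚ (ε³*n≤ε*opt ε (1/m*m≡1 m) (subst (ℕ→ℚ n ≤_) m²opt≡ (ℕ→ℚ-mono-≤ n≤m²opt))) ⟩
    ε * ℕ→ℚ opt + 1ℚ  ∎
    where open ℚ.≤-Reasoning
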